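{- Let $h(x)$ be a polynomial with real coefficients. For integers $m$ and $l$ put $F_{h,m}^l(x)=\sum_{i=0}^{l}\binom{m-1-i}{i}h^{m-2i-1}(x)$ when $0\le l\le\lfloor (m-1)/2\rfloor$ and $F_{h,m}^l(x)=0$ when $l<0$; for $n\ge1$, $0\le l\le\lfloor n/2\rfloor$ put $L_{h,n}^l(x)=\sum_{i=0}^{l}\frac{n}{n-i}\binom{n-i}{i}h^{n-2i}(x)$. Then for every integer $n\ge1$ and $0\le l\le\lfloor (n-1)/2\rfloor$, $$h(x)L_{h,n}^{l}(x)=F_{h,n+2}^{l}(x)-F_{h,n-2}^{l-2}(x).$$
   Context: $h(x)$ is a polynomial with real coefficients; $h^k(x)$ denotes $(h(x))^k$. $F_{h,n}^l$ and $L_{h,n}^l$ are the incomplete $h(x)$-Fibonacci and $h(x)$-Lucas polynomials. -}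

module Defs where

open import Level using (Level)
open import Data.Nat as ℕ using (ℕ; zero; suc; _∸_)
open import Data.Nat.DivMod using (_/_)
open import Data.Nat.Combinatorics using (_C_)
open import Data.Integer using (ℤ; +_; -[1+_]; ∣_∣)
open import Algebra.Bundles using (CommutativeRing; Semiring)
import Algebra.Definitions.RawSemiring as RS

module _ {c ℓ : Level} (R : CommutativeRing c ℓ) where
  open CommutativeRing R
  open RS (Semiring.rawSemiring semiring) using (_×_; _^_)

  sumUpTo : (ℕ → Carrier) → ℕ → Carrier
  sumUpTo f zero    = f 0
  sumUpTo f (suc l) = sumUpTo f l + f (suc l)

  -- incomplete h-Fibonacci polynomial F_{h,m}^l, with F = 0 for l < 0.
  -- (For l ≥ 0 the formula is meant for m ≥ 1, 0 ≤ l ≤ ⌊(m-1)/2⌋.)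
  Fib : Carrier → ℤ → ℤ → Carrier
  Fib h m -[1+ k ] = 0#
  Fib h m (+ l)    = sumUpTo (λ i → ((∣ m ∣ ∸ 1 ∸ i) C i) × (h ^ (∣ m ∣ ∸ 2 ℕ.* i ∸ 1))) l

  -- coefficient n/(n-i) * C(n-i, i)  (an integer for 0 ≤ i ≤ n/2, n ≥ 1)
  lucasCoef : ℕ → ℕ → ℕ
  lucasCoef n i with n ∸ i
  ... | zero  = 0
  ... | suc k = (n ℕ.* ((n ∸ i) C i)) / suc k

  Luc : Carrier → ℕ → ℕ → Carrier
  Luc h n l = sumUpTo (λ i → lucasCoef n i × (h ^ (n ∸ 2 ℕ.* i))) l

{-# OPTIONS --safe #-}
-- Compare the coefficients of h^(n+1-2i) for each i ≤ l, after re-indexing F_{h,n-2}^{l-2}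
-- by two (shift₂) so that all three sums run over i ≤ l.  With n - i = k + 1, absorption
-- i·C(k+1,i) = (k+1)·C(k,i-1) turns the Lucas coefficient n/(n-i)·C(n-i,i) into
-- C(k+1,i) + C(k,i-1), so the claim is C(k+1,i) + C(k,i-1) + C(k,i-2) = C(k+2,i): two Pascal steps.
-- The bound l ≤ ⌊(n-1)/2⌋ gives 2i < n, which makes every truncated subtraction in the exponents exact.
module Submission where

open import Defs
open import Level using (Level)
open import Data.Nat using (ℕ; _≤_; _∸_; _+_)
open import Data.Nat.DivMod using (_/_)
open import Data.Integer as ℤ using (+_)
open import Algebra.Bundles using (CommutativeRing; Semiring)

open import Data.Nat using (zero; suc; _*_; _<_; s≤s; z≤n)
import Data.Nat.Properties as ℕ
open import Data.Nat.Properties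
  using (+-assoc; +-comm; *-comm; *-identityˡ; *-identityʳ; *-zeroʳ; *-distribʳ-+;
         m+n∸m≡n; m≤m+n; m≤n⇒m≤1+n; ≤-refl; ≤-trans; ≤-reflexive; <⇒≤; ≤-<-trans; *-monoʳ-≤;
         m≤n⇒∃[o]m+o≡n)
open import Data.Nat.DivMod using (m*n/n≡m; m/n*n≤m)
open import Data.Nat.Combinatorics using (_C_; nC1≡n; nCk+nC[k+1]≡[n+1]C[k+1])
open import Data.Nat.Tactic.RingSolver using (solve-∀)
open import Data.Product using (_,_)
open import Relation.Binary.PropositionalEquality
  using (_≡_; refl; sym; trans; cong; cong₂; subst; module ≡-Reasoning)
import Algebra.Definitions.RawSemiring as RawSemiringDefinitions
import Algebra.Properties.Semiring.Mult as SemiringMultProperties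
import Algebra.Properties.CommutativeSemigroup as CommutativeSemigroupProperties
import Algebra.Properties.AbelianGroup as AbelianGroupProperties
import Relation.Binary.Reasoning.Setoid as SetoidReasoning

shift₂ : ∀ {a} {A : Set a} → A → (ℕ → A) → ℕ → A
shift₂ z f zero          = z
shift₂ z f (suc zero)    = z
shift₂ z f (suc (suc i)) = f i

[1+k]*[1+n]C[1+k]≡[1+n]*nCk : ∀ n k → suc k * (suc n C suc k) ≡ suc n * (n C k)
[1+k]*[1+n]C[1+k]≡[1+n]*nCk zero    zero    = refl
[1+k]*[1+n]C[1+k]≡[1+n]*nCk zero    (suc k) = *-zeroʳ (suc (suc k))
[1+k]*[1+n]C[1+k]≡[1+n]*nCk (suc n) zero    =
  trans (*-identityˡ _) (trans (nC1≡n (suc (suc n))) (sym (*-identityʳ _)))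
[1+k]*[1+n]C[1+k]≡[1+n]*nCk (suc n) (suc k) = begin
    suc (suc k) * (suc (suc n) C suc (suc k))
  ≡⟨ cong (suc (suc k) *_) (sym (nCk+nC[k+1]≡[n+1]C[k+1] (suc n) (suc k))) ⟩
    suc (suc k) * (a + b)
  ≡⟨ expand k a b ⟩
    a + suc k * a + suc (suc k) * b
  ≡⟨ cong₂ (λ u v → a + u + v) ([1+k]*[1+n]C[1+k]≡[1+n]*nCk n k)
                                ([1+k]*[1+n]C[1+k]≡[1+n]*nCk n (suc k)) ⟩
    a + suc n * (n C k) + suc n * (n C suc k)
  ≡⟨ collect n a (n C k) (n C suc k) ⟩
    a + suc n * (n C k + n C suc k)
  ≡⟨ cong (λ u → a + suc n * u) (nCk+nC[k+1]≡[n+1]C[k+1] n k) ⟩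
    suc (suc n) * a
  ∎
  where
  open ≡-Reasoning
  a b : ℕ
  a = suc n C suc k
  b = suc n C suc (suc k)
  expand : ∀ k a b → suc (suc k) * (a + b) ≡ a + suc k * a + suc (suc k) * b
  expand = solve-∀
  collect : ∀ n a x y → a + suc n * x + suc n * y ≡ a + suc n * (x + y)
  collect = solve-∀

module _ {c ℓ : Level} (R : CommutativeRing c ℓ) where

  lucasCoef-≡ : ∀ n i k → n ∸ i ≡ suc k → lucasCoef R n i ≡ n * (suc k C i) / suc k
  lucasCoef-≡ n i k n∸i≡1+k with n ∸ i in eq
  lucasCoef-≡ n i k ()   | zero
  lucasCoef-≡ n i k refl | suc _ = cong (λ m → n * (m C i) / suc k) eq

  lucasCoef-zero : ∀ k → lucasCoef R (suc k) 0 ≡ 1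
  lucasCoef-zero k =
    trans (lucasCoef-≡ (suc k) 0 k refl) (trans (cong (_/ suc k) (*-comm (suc k) 1)) (m*n/n≡m 1 (suc k)))

  lucasCoef-suc : ∀ i k → lucasCoef R (suc i + suc k) (suc i) ≡ suc k C suc i + k C i
  lucasCoef-suc i k =
    trans (lucasCoef-≡ (suc i + suc k) (suc i) k (m+n∸m≡n (suc i) (suc k)))
          (trans (cong (_/ suc k) absorbed) (m*n/n≡m (a + k C i) (suc k)))
    where
    open ≡-Reasoning
    a : ℕ
    a = suc k C suc i
    absorbed : (suc i + suc k) * a ≡ (a + k C i) * suc k
    absorbed = begin
        (suc i + suc k) * a
      ≡⟨ *-distribʳ-+ a (suc i) (suc k) ⟩
        suc i * a + suc k * a
      ≡⟨ cong (_+ suc k * a) ([1+k]*[1+n]C[1+k]≡[1+n]*nCk k i) ⟩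
        suc k * (k C i) + suc k * a
      ≡⟨ factor (suc k) (k C i) a ⟩
        (a + k C i) * suc k
      ∎
      where
      factor : ∀ m x y → m * x + m * y ≡ (y + x) * m
      factor = solve-∀

  lucasCoef+shift₂C≡C : ∀ i k → lucasCoef R (i + suc k) i + shift₂ 0 (k C_) i ≡ suc (suc k) C i
  lucasCoef+shift₂C≡C zero          k = trans (ℕ.+-identityʳ _) (lucasCoef-zero k)
  lucasCoef+shift₂C≡C (suc zero)    k = begin
      lucasCoef R (suc (suc k)) 1 + 0
    ≡⟨ ℕ.+-identityʳ _ ⟩
      lucasCoef R (suc (suc k)) 1
    ≡⟨ lucasCoef-suc 0 k ⟩
      suc k C 1 + k C 0
    ≡⟨ +-comm (suc k C 1) 1 ⟩
      suc k C 0 + suc k C 1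
    ≡⟨ nCk+nC[k+1]≡[n+1]C[k+1] (suc k) 0 ⟩
      suc (suc k) C 1
    ∎
    where open ≡-Reasoning
  lucasCoef+shift₂C≡C (suc (suc j)) k = begin
      lucasCoef R (suc (suc j) + suc k) (suc (suc j)) + k C j
    ≡⟨ cong (_+ k C j) (lucasCoef-suc (suc j) k) ⟩
      suc k C suc (suc j) + k C suc j + k C j
    ≡⟨ trans (+-assoc top _ _) (cong (_+_ top) (+-comm (k C suc j) _)) ⟩
      suc k C suc (suc j) + (k C j + k C suc j)
    ≡⟨ cong (_+_ top) (nCk+nC[k+1]≡[n+1]C[k+1] k j) ⟩
      suc k C suc (suc j) + suc k C suc j
    ≡⟨ +-comm top _ ⟩
      suc k C suc j + suc k C suc (suc j)
    ≡⟨ nCk+nC[k+1]≡[n+1]C[k+1] (suc k) (suc j) ⟩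
      suc (suc k) C suc (suc j)
    ∎
    where
    open ≡-Reasoning
    top : ℕ
    top = suc k C suc (suc j)

module _ {c ℓ : Level} (R : CommutativeRing c ℓ) where
  open CommutativeRing R
    renaming (_+_ to _⊕_; _*_ to _⊛_; refl to ≈-refl; sym to ≈-sym; trans to ≈-trans)
  open RawSemiringDefinitions (Semiring.rawSemiring semiring) using (_×_; _^_)
  open SemiringMultProperties semiring using (×-comm-*; ×-homo-+)
  open CommutativeSemigroupProperties +-commutativeSemigroup using (interchange)
  open SetoidReasoning setoid

  sumUpTo-cong : ∀ {f g} l → (∀ i → i ≤ l → f i ≈ g i) → sumUpTo R f l ≈ sumUpTo R g l
  sumUpTo-cong zero    f≈g = f≈g 0 z≤n
  sumUpTo-cong (suc l) f≈g = +-cong (sumUpTo-cong l (λ i i≤l → f≈g i (m≤n⇒m≤1+n i≤l))) (f≈g (suc l) ≤-refl)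

  *-distribˡ-sumUpTo : ∀ x f l → x ⊛ sumUpTo R f l ≈ sumUpTo R (λ i → x ⊛ f i) l
  *-distribˡ-sumUpTo x f zero    = ≈-refl
  *-distribˡ-sumUpTo x f (suc l) = ≈-trans (distribˡ x _ _) (+-congʳ (*-distribˡ-sumUpTo x f l))

  sumUpTo-homo-+ : ∀ f g l → sumUpTo R f l ⊕ sumUpTo R g l ≈ sumUpTo R (λ i → f i ⊕ g i) l
  sumUpTo-homo-+ f g zero    = ≈-refl
  sumUpTo-homo-+ f g (suc l) = ≈-trans (interchange _ _ _ _) (+-congʳ (sumUpTo-homo-+ f g l))

  sumUpTo-shift₂ : ∀ f k → sumUpTo R (shift₂ 0# f) (suc (suc k)) ≈ sumUpTo R f k
  sumUpTo-shift₂ f zero    = ≈-trans (+-congʳ (+-identityˡ 0#)) (+-identityˡ (f 0))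
  sumUpTo-shift₂ f (suc k) = +-congʳ (sumUpTo-shift₂ f k)

  x*[m×xᵉ]+n×x¹⁺ᵉ≈[m+n]×x¹⁺ᵉ : ∀ x m n e → x ⊛ (m × x ^ e) ⊕ n × x ^ suc e ≈ (m + n) × x ^ suc e
  x*[m×xᵉ]+n×x¹⁺ᵉ≈[m+n]×x¹⁺ᵉ x m n e = begin
      x ⊛ (m × x ^ e) ⊕ n × x ^ suc e
    ≈⟨ +-congʳ (×-comm-* m x (x ^ e)) ⟩
      m × x ^ suc e ⊕ n × x ^ suc e
    ≈⟨ ×-homo-+ (x ^ suc e) m n ⟨
      (m + n) × x ^ suc e
    ∎

  module _ (h : Carrier) where

    fibTerm : ℕ → ℕ → Carrier
    fibTerm m i = ((m ∸ 1 ∸ i) C i) × h ^ (m ∸ 2 * i ∸ 1)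

    lucTerm : ℕ → ℕ → Carrier
    lucTerm n i = lucasCoef R n i × h ^ (n ∸ 2 * i)

    fibTerm-≡ : ∀ {m} i k e → m ≡ suc (i + k) → m ≡ 2 * i + suc e → fibTerm m i ≡ (k C i) × h ^ e
    fibTerm-≡ i k e refl m≡2i+1+e = cong₂ (λ a b → (a C i) × h ^ b)
      (m+n∸m≡n i k)
      (trans (cong (λ m → m ∸ 2 * i ∸ 1) m≡2i+1+e) (cong (_∸ 1) (m+n∸m≡n (2 * i) (suc e))))

    lucTerm-≡ : ∀ {n} i e → n ≡ 2 * i + e → lucTerm n i ≡ lucasCoef R n i × h ^ e
    lucTerm-≡ {n} i e n≡2i+e =
      cong (λ d → lucasCoef R n i × h ^ d) (trans (cong (_∸ 2 * i) n≡2i+e) (m+n∸m≡n (2 * i) e))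

    shift₂-fibTerm : ∀ i r → shift₂ 0# (fibTerm (i + suc (i + r) ∸ 2)) i ≡ shift₂ 0 ((i + r) C_) i × h ^ suc (suc r)
    shift₂-fibTerm zero          r = refl
    shift₂-fibTerm (suc zero)    r = refl
    shift₂-fibTerm (suc (suc j)) r = fibTerm-≡ j (suc (suc j) + r) (suc (suc r)) (n∸2≡1+j+k j r) (n∸2≡2j+3+r j r)
      where
      n∸2≡1+j+k : ∀ j r → j + suc (suc (suc j) + r) ≡ suc (j + (suc (suc j) + r))
      n∸2≡1+j+k = solve-∀
      n∸2≡2j+3+r : ∀ j r → j + suc (suc (suc j) + r) ≡ 2 * j + suc (suc (suc r))
      n∸2≡2j+3+r = solve-∀

    h*lucTerm+shift₂-fibTerm≈fibTerm : ∀ {n} i → 2 * i < n →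
      h ⊛ lucTerm n i ⊕ shift₂ 0# (fibTerm (n ∸ 2)) i ≈ fibTerm (n + 2) i
    h*lucTerm+shift₂-fibTerm≈fibTerm i 2i<n with m≤n⇒∃[o]m+o≡n 2i<n
    ... | r , refl = subst (λ n → h ⊛ lucTerm n i ⊕ shift₂ 0# (fibTerm (n ∸ 2)) i ≈ fibTerm (n + 2) i)
                           (split i r) identity
      where
      split : ∀ i r → i + suc (i + r) ≡ suc (2 * i) + r
      split = solve-∀
      n k : ℕ
      n = i + suc (i + r)
      k = i + r
      n≡2i+1+r : ∀ i r → i + suc (i + r) ≡ 2 * i + suc r
      n≡2i+1+r = solve-∀
      n+2≡1+i+[2+k] : ∀ i r → i + suc (i + r) + 2 ≡ suc (i + suc (suc (i + r)))
      n+2≡1+i+[2+k] = solve-∀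
      n+2≡2i+3+r : ∀ i r → i + suc (i + r) + 2 ≡ 2 * i + suc (suc (suc r))
      n+2≡2i+3+r = solve-∀
      identity : h ⊛ lucTerm n i ⊕ shift₂ 0# (fibTerm (n ∸ 2)) i ≈ fibTerm (n + 2) i
      identity = begin
          h ⊛ lucTerm n i ⊕ shift₂ 0# (fibTerm (n ∸ 2)) i
        ≡⟨ cong₂ (λ a b → h ⊛ a ⊕ b) (lucTerm-≡ i (suc r) (n≡2i+1+r i r)) (shift₂-fibTerm i r) ⟩
          h ⊛ (lucasCoef R n i × h ^ suc r) ⊕ shift₂ 0 (k C_) i × h ^ suc (suc r)
        ≈⟨ x*[m×xᵉ]+n×x¹⁺ᵉ≈[m+n]×x¹⁺ᵉ h (lucasCoef R n i) (shift₂ 0 (k C_) i) (suc r) ⟩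
          (lucasCoef R n i + shift₂ 0 (k C_) i) × h ^ suc (suc r)
        ≡⟨ cong (_× h ^ suc (suc r)) (lucasCoef+shift₂C≡C R i k) ⟩
          (suc (suc k) C i) × h ^ suc (suc r)
        ≡⟨ sym (fibTerm-≡ i (suc (suc k)) (suc (suc r)) (n+2≡1+i+[2+k] i r) (n+2≡2i+3+r i r)) ⟩
          fibTerm (n + 2) i
        ∎

    h*Luc+shift₂-sum≈Fib : ∀ {n} l → 2 * l < n →
      h ⊛ Luc R h n l ⊕ sumUpTo R (shift₂ 0# (fibTerm (n ∸ 2))) l ≈ Fib R h (+ (n + 2)) (+ l)
    h*Luc+shift₂-sum≈Fib {n} l 2l<n = begin
        h ⊛ Luc R h n l ⊕ sumUpTo R (shift₂ 0# (fibTerm (n ∸ 2))) l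
      ≈⟨ +-congʳ (*-distribˡ-sumUpTo h (lucTerm n) l) ⟩
        sumUpTo R (λ i → h ⊛ lucTerm n i) l ⊕ sumUpTo R (shift₂ 0# (fibTerm (n ∸ 2))) l
      ≈⟨ sumUpTo-homo-+ _ _ l ⟩
        sumUpTo R (λ i → h ⊛ lucTerm n i ⊕ shift₂ 0# (fibTerm (n ∸ 2)) i) l
      ≈⟨ sumUpTo-cong l (λ i i≤l → h*lucTerm+shift₂-fibTerm≈fibTerm i (≤-<-trans (*-monoʳ-≤ 2 i≤l) 2l<n)) ⟩
        sumUpTo R (fibTerm (n + 2)) l
      ∎

    -- For l < 2 the index l - 2 is negative and Fib is 0; otherwise l ≤ n makes ∣ n - 2 ∣ = n ∸ 2.
    Fib[n-2,l-2]≈sumUpTo-shift₂ : ∀ {n l} → l ≤ n →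
      Fib R h (+ n ℤ.- + 2) (+ l ℤ.- + 2) ≈ sumUpTo R (shift₂ 0# (fibTerm (n ∸ 2))) l
    Fib[n-2,l-2]≈sumUpTo-shift₂ {l = zero}        _             = ≈-refl
    Fib[n-2,l-2]≈sumUpTo-shift₂ {l = suc zero}    _             = ≈-sym (+-identityʳ 0#)
    Fib[n-2,l-2]≈sumUpTo-shift₂ {l = suc (suc k)} (s≤s (s≤s _)) = ≈-sym (sumUpTo-shift₂ (fibTerm _) k)

2*l<n : ∀ {n l} → 1 ≤ n → l ≤ (n ∸ 1) / 2 → 2 * l < n
2*l<n {suc n} _ l≤n/2 =
  s≤s (≤-trans (*-monoʳ-≤ 2 l≤n/2) (≤-trans (≤-reflexive (*-comm 2 (n / 2))) (m/n*n≤m n 2)))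

proposition11 : {c ℓ : Level} (R : CommutativeRing c ℓ) (h : CommutativeRing.Carrier R)
    (n l : ℕ) → 1 ≤ n → l ≤ (n ∸ 1) / 2 →
    CommutativeRing._≈_ R
      (CommutativeRing._*_ R h (Luc R h n l))
      (CommutativeRing._-_ R (Fib R h (+ (n + 2)) (+ l)) (Fib R h ((+ n) ℤ.- (+ 2)) ((+ l) ℤ.- (+ 2))))
proposition11 R h n l 1≤n l≤[n-1]/2 = x≈z//y _ _ _ (begin
    h ⊛ Luc R h n l ⊕ Fib R h (+ n ℤ.- + 2) (+ l ℤ.- + 2)
  ≈⟨ +-congˡ (Fib[n-2,l-2]≈sumUpTo-shift₂ R h l≤n) ⟩
    h ⊛ Luc R h n l ⊕ sumUpTo R (shift₂ 0# (fibTerm R h (n ∸ 2))) l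
  ≈⟨ h*Luc+shift₂-sum≈Fib R h l 2l<n ⟩
    Fib R h (+ (n + 2)) (+ l)
  ∎)
  where
  open CommutativeRing R
    using (0#; +-congˡ; setoid; +-abelianGroup) renaming (_+_ to _⊕_; _*_ to _⊛_)
  open AbelianGroupProperties +-abelianGroup using (x≈z//y)
  open SetoidReasoning setoid
  2l<n : 2 * l < n
  2l<n = 2*l<n 1≤n l≤[n-1]/2
  l≤n : l ≤ n
  l≤n = ≤-trans (m≤m+n l (l + 0)) (<⇒≤ 2l<n)
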